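{- Fix a 3-moding. Let $P$ be a well-3-moded program in which each clause head is weakly linear, and let $Q$ be a well-3-moded query. Then $P$ with $Q$ is weakly occur-check free under the Prolog selection rule; and if no argument position is moded as output, then $P$ with $Q$ is weakly occur-check free under any selection rule.
   Context: A 3-moding assigns to each argument position of each predicate one of $+$ (input), $-$ (output), $\bot$ (neutral). An atom is weakly linear if every variable occurring more than once in it occurs in an input ($+$) position. In a clause $C=H\gets B_1,\ldots,B_m$, a defining occurrence of $V$ is an occurrence in an input position of $H$ or an output position of some $B_i$; $C$ is well-3-moded if each variable in an output position of $H$ has a defining occurrence in $C$, and each occurrence of a variable $V$ in an input position of some $B_j$ is preceded (in the order $H,B_1,\ldots,B_m$) by a defining occurrence of $V$ in another atom of $C$. A query $Q$ is well-3-moded if the clause $p\gets Q$ is; a program is well-3-moded if all its clauses are. The Prolog selection rule selects the leftmost atom. MMA (Martelli–Montanari algorithm) operates on a finite equation set by nondeterministically choosing an equation and applying: (1) $f(s_1,\ldots,s_n)\doteq f(t_1,\ldots,t_n)$ → replace by $s_i\doteq t_i$; (2) $f(\ldots)\doteq g(\ldots)$, $f\ne g$ → fail; (3) $X\doteq X$ → delete; (4) $t\doteq X$, $t$ not a variable → replace by $X\doteq t$; (5) $X\doteq t$, $X\notin Var(t)$, $X$ occurring elsewhere → apply $\{X/t\}$ to all other equations; (6) $X\doteq t$, $X\in Var(t)$, $X\ne t$ → fail. An equation set is WNSTO if some run of MMA on it does not perform action (6). In an SLD-tree for $P$ with $Q$, the unification $\{A\doteq H\}$ is available if $A$ is the selected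 atom of a query in the tree and $H$ is a standardized-apart head of a clause of $P$ with the same predicate symbol. $P$ with $Q$ is weakly occur-check free (under a selection rule) if all unifications available in its SLD-tree are WNSTO. -}

module Defs where

open import Data.Nat using (ℕ; zero; suc; _≤_; _≡ᵇ_)
open import Data.Bool using (if_then_else_)
open import Data.Fin using (Fin; toℕ)
open import Data.List using (List; []; _∷_; _++_; length; lookup; take; drop; zip)
open import Data.List.Relation.Unary.Any using (Any)
open import Data.List.Relation.Unary.All using (All)
open import Data.List.Membership.Propositional using (_∈_)
open import Data.Product using (_×_; _,_; Σ; ∃; ∃-syntax)
open import Data.Sum using (_⊎_)
open import Data.Empty using (⊥)
open import Relation.Nullary using (¬_)
open import Relation.Binary.PropositionalEquality using (_≡_; _≢_)
open import Relation.Binary.Construct.Closure.ReflexiveTransitive using (Star)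
open import Function.Definitions using (Injective)

-- Terms, atoms, clauses, programs, queries
-- Variables and function symbols are named by natural numbers; a
-- function symbol is identified by its name together with its arity
-- (the length of its argument list).

data Term : Set where
  var : ℕ → Term
  fn  : ℕ → List Term → Term

-- A predicate symbol is a name together with an arity (= length args).
record Atom : Set where
  constructor atom
  field
    pred : ℕ
    args : List Term
open Atom public

record Clause : Set where
  constructor _⇐_
  field
    head : Atom
    body : List Atom
open Clause public

Query : Set
Query = List Atom

Program : Set
Program = List Clause

data _∈ᵥ_ (x : ℕ) : Term → Set where
  here  : x ∈ᵥ var x
  there : ∀ {f ts} → Any (x ∈ᵥ_) ts → x ∈ᵥ fn f ts

_∈ᵥA_ : ℕ → Atom → Set
x ∈ᵥA A = Any (x ∈ᵥ_) (args A)

_∈ᵥQ_ : ℕ → Query → Set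
x ∈ᵥQ Q = Any (x ∈ᵥA_) Q

_∈ᵥC_ : ℕ → Clause → Set
x ∈ᵥC C = x ∈ᵥA head C ⊎ x ∈ᵥQ body C

mutual
  occ : ℕ → Term → ℕ
  occ x (var y)  = if x ≡ᵇ y then 1 else 0
  occ x (fn f ts) = occs x ts

  occs : ℕ → List Term → ℕ
  occs x []       = 0
  occs x (t ∷ ts) = occ x t Data.Nat.+ occs x ts

Subst : Set
Subst = ℕ → Term

mutual
  sub : Subst → Term → Term
  sub θ (var x)   = θ x
  sub θ (fn f ts) = fn f (subs θ ts)

  subs : Subst → List Term → List Term
  subs θ []       = []
  subs θ (t ∷ ts) = sub θ t ∷ subs θ ts

subA : Subst → Atom → Atom
subA θ (atom p ts) = atom p (subs θ ts)

subQ : Subst → Query → Query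
subQ θ []      = []
subQ θ (A ∷ Q) = subA θ A ∷ subQ θ Q

subC : Subst → Clause → Clause
subC θ (H ⇐ B) = subA θ H ⇐ subQ θ B

rename : (ℕ → ℕ) → Clause → Clause
rename ρ C = subC (λ x → var (ρ x)) C

data Mode : Set where
  inp out neutral : Mode

-- A 3-moding: mode of position i of predicate symbol (name p, arity n)
Moding : Set
Moding = ℕ → ℕ → ℕ → Mode

modeAt : Moding → (A : Atom) → Fin (length (args A)) → Mode
modeAt M A i = M (pred A) (length (args A)) (toℕ i)

OccAt : Moding → Mode → Atom → ℕ → Set
OccAt M m A x =
  Σ (Fin (length (args A))) λ i → (modeAt M A i ≡ m) × (x ∈ᵥ lookup (args A) i)

InPos OutPos : Moding → Atom → ℕ → Set
InPos  M = OccAt M inp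
OutPos M = OccAt M out

WeaklyLinear : Moding → Atom → Set
WeaklyLinear M A = ∀ x → 2 ≤ occs x (args A) → InPos M A x

DefinedIn : Moding → Atom → List Atom → ℕ → Set
DefinedIn M H Bs x = InPos M H x ⊎ Any (λ B → OutPos M B x) Bs

WellModedClause : Moding → Clause → Set
WellModedClause M (H ⇐ B) =
  (∀ x → OutPos M H x → DefinedIn M H B x) ×
  (∀ (j : Fin (length B)) x → InPos M (lookup B j) x →
     DefinedIn M H (take (toℕ j) B) x)

-- query Q is well-moded iff the clause  p ← Q  is (p a 0-ary atom)
WellModedQuery : Moding → Query → Set
WellModedQuery M Q = WellModedClause M (atom 0 [] ⇐ Q)

WellModedProgram : Moding → Program → Set
WellModedProgram M P = All (WellModedClause M) P

Equation : Set
Equation = Term × Term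

EqSet : Set
EqSet = List Equation

OccursInE : ℕ → EqSet → Set
OccursInE x E = Any (λ e → x ∈ᵥ Data.Product.proj₁ e ⊎ x ∈ᵥ Data.Product.proj₂ e) E

single : ℕ → Term → Subst
single x t y = if y ≡ᵇ x then t else var y

subE : Subst → EqSet → EqSet
subE θ []            = []
subE θ ((s , t) ∷ E) = (sub θ s , sub θ t) ∷ subE θ E

-- One MMA step performing one of the actions (1),(3),(4),(5) on the
-- chosen equation (E₁ ++ e ∷ E₂ chooses e).  The step 'merge' only
-- reflects that equation sets are sets (identifies duplicates).
data MMAStep : EqSet → EqSet → Set where
  act1  : ∀ E₁ E₂ f ss ts → length ss ≡ length ts →
          MMAStep (E₁ ++ (fn f ss , fn f ts) ∷ E₂) (E₁ ++ zip ss ts ++ E₂)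
  act3  : ∀ E₁ E₂ x →
          MMAStep (E₁ ++ (var x , var x) ∷ E₂) (E₁ ++ E₂)
  act4  : ∀ E₁ E₂ f ts x →
          MMAStep (E₁ ++ (fn f ts , var x) ∷ E₂) (E₁ ++ (var x , fn f ts) ∷ E₂)
  act5  : ∀ E₁ E₂ x t → ¬ (x ∈ᵥ t) → OccursInE x (E₁ ++ E₂) →
          MMAStep (E₁ ++ (var x , t) ∷ E₂)
                  (subE (single x t) E₁ ++ (var x , t) ∷ subE (single x t) E₂)
  merge : ∀ E₁ E₂ e → e ∈ (E₁ ++ E₂) →
          MMAStep (E₁ ++ e ∷ E₂) (E₁ ++ E₂)

-- action (2) applicable: a clash of function symbols (name or arity)
Clash : Equation → Set
Clash (fn f ss , fn g ts) = f ≢ g ⊎ length ss ≢ length ts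
Clash _                   = ⊥

-- an equation to which none of the actions (1)-(6) applies, given the
-- remaining equations
Solved : Equation → EqSet → Set
Solved (var x , t)    rest = ¬ (x ∈ᵥ t) × ¬ OccursInE x rest
Solved (fn _ _ , _)   rest = ⊥

Terminal : EqSet → Set
Terminal E = ∀ E₁ e E₂ → E ≡ E₁ ++ e ∷ E₂ → Solved e (E₁ ++ E₂)

-- WNSTO: some (maximal) run of MMA does not perform action (6):
-- a sequence of actions other than (6) ending either in failure by
-- action (2) or in a state where no action applies.
WNSTO : EqSet → Set
WNSTO E = ∃[ E' ] (Star MMAStep E E' × (Any Clash E' ⊎ Terminal E'))

atomTerm : Atom → Term
atomTerm (atom p ts) = fn p ts

SamePred : Atom → Atom → Set
SamePred A B = (pred A ≡ pred B) × (length (args A) ≡ length (args B))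

Unifier : Subst → Atom → Atom → Set
Unifier θ A B = subA θ A ≡ subA θ B

MGU : Subst → Atom → Atom → Set
MGU θ A B = Unifier θ A B ×
  (∀ σ → Unifier σ A B → ∃[ δ ] (∀ x → sub δ (θ x) ≡ σ x))

-- A selection rule chooses an atom of a non-empty query a ∷ q; it may
-- depend on the history (list of earlier queries of the derivation,
-- most recent first).
SelectionRule : Set
SelectionRule = List Query → (a : Atom) → (q : Query) → Fin (suc (length q))

prologRule : SelectionRule
prologRule _ _ _ = Data.Fin.zero

selected : SelectionRule → List Query → Atom → Query → Atom
selected R h a q = lookup (a ∷ q) (R h a q)

replaceAt : (Q : Query) → Fin (length Q) → Query → Query
replaceAt Q i Bs = take (toℕ i) Q ++ Bs ++ drop (suc (toℕ i)) Q

Variant : Clause → Query → Clause → Set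
Variant C Q C' = ∃[ ρ ] (Injective _≡_ _≡_ ρ × (C' ≡ rename ρ C) ×
                        (∀ x → x ∈ᵥC C' → ¬ (x ∈ᵥQ Q)))

-- Nodes of the SLD-tree of P with Q₀ via R, given as the path
-- (current query ∷ earlier queries … ∷ Q₀ ∷ [])
data SLDNode (P : Program) (R : SelectionRule) (Q₀ : Query) : List Query → Set where
  root : SLDNode P R Q₀ (Q₀ ∷ [])
  step : ∀ {a q h} → SLDNode P R Q₀ ((a ∷ q) ∷ h) →
         ∀ C → C ∈ P → ∀ C' → Variant C (a ∷ q) C' →
         ∀ θ → MGU θ (selected R h a q) (head C') →
         SLDNode P R Q₀
           (subQ θ (replaceAt (a ∷ q) (R h a q) (body C')) ∷ (a ∷ q) ∷ h)

WeaklyOCFree : Program → SelectionRule → Query → Set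
WeaklyOCFree P R Q₀ =
  ∀ {a q h} → SLDNode P R Q₀ ((a ∷ q) ∷ h) →
  ∀ C → C ∈ P → ∀ C' → Variant C (a ∷ q) C' →
  SamePred (selected R h a q) (head C') →
  WNSTO ((atomTerm (selected R h a q) , atomTerm (head C')) ∷ [])

NoOutput : Moding → Set
NoOutput M = ∀ p n i → M p n i ≢ out

-- The selected atom A of every query in the tree has no variable in an input
-- position: under the Prolog rule because well-modedness is preserved by resolution
-- and forces the leftmost atom's inputs to be ground, and without output positions
-- because then every input variable of a clause body occurs in an input of the head,
-- which the unifier grounds against the selected atom.  Unifying such an A with a
-- standardized-apart, weakly linear head H is WNSTO.  After decomposing A ≐ H,
-- MMA first treats the equations whose left side is ground: they bind variables of
-- H to ground terms, and every variable repeated in H occurs opposite a ground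
-- argument of A.  What remains has linear right-hand sides that share no variable
-- with the left-hand sides, and on such a set every variable elimination passes
-- the occur check.  The two phases terminate by the size of the left, resp. right,
-- sides of the unprocessed equations.

module Submission where

open import Defs
open import Data.Nat hiding (pred)
open import Data.Nat.Properties
open import Data.Nat.Solver using (module +-*-Solver)
open import Data.Bool using (true; false)
open import Data.Unit using (⊤; tt)
open import Data.Empty using (⊥-elim)
open import Data.Fin using (Fin; toℕ; zero; suc)
open import Data.List using (List; []; _∷_; _++_; length; map; zip; lookup; take; drop; [_])
open import Data.List.Properties using (map-++; ++-assoc; ++-identityʳ)
open import Data.List.Relation.Unary.Any using (Any; here; there)
open import Data.List.Relation.Unary.All using (All; []; _∷_)
import Data.List.Relation.Unary.Any.Properties as Any
import Data.List.Relation.Unary.All as All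
import Data.List.Relation.Unary.All.Properties as All
open import Data.List.Membership.Propositional using (_∈_; lose)
open import Data.List.Membership.Propositional.Properties using (∈-lookup)
open import Data.Product using (_×_; _,_; proj₁; proj₂; ∃-syntax)
open import Data.Sum using (inj₁; inj₂; map₁; fromInj₁)
open import Function using (_∘_)
open import Function.Definitions using (Injective)
open import Level using (0ℓ)
open import Relation.Nullary using (¬_; Dec; yes; no)
open import Relation.Unary using (Pred; _⊆_; _∪_; ∅)
open import Relation.Binary.PropositionalEquality hiding ([_])
open import Relation.Binary.Construct.Closure.ReflexiveTransitive using (Star; ε; _◅_; _◅◅_)

-- Variable occurrences and substitution

occ-var-self : ∀ x → occ x (var x) ≡ 1
occ-var-self x with x ≡ᵇ x | ≡⇒≡ᵇ x x refl
... | true | _ = refl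

occ-var-≢ : ∀ {x y} → x ≢ y → occ x (var y) ≡ 0
occ-var-≢ {x} {y} x≢y with x ≡ᵇ y | ≡ᵇ⇒≡ x y
... | true  | x≡y = ⊥-elim (x≢y (x≡y tt))
... | false | _   = refl

occ-var>0 : ∀ {x y} → 0 < occ x (var y) → x ≡ y
occ-var>0 {x} {y} p with x ≡ᵇ y | ≡ᵇ⇒≡ x y
... | true | x≡y = x≡y tt

mutual
  ∈⇒occ>0 : ∀ {x t} → x ∈ᵥ t → 0 < occ x t
  ∈⇒occ>0 {x} here = subst (0 <_) (sym (occ-var-self x)) z<s
  ∈⇒occ>0 (there x∈ts) = ∈⇒occs>0 x∈ts

  ∈⇒occs>0 : ∀ {x ts} → Any (x ∈ᵥ_) ts → 0 < occs x ts
  ∈⇒occs>0 {x} {t ∷ ts} (here x∈t)   = ≤-trans (∈⇒occ>0 x∈t) (m≤m+n (occ x t) (occs x ts))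
  ∈⇒occs>0 {x} {t ∷ ts} (there x∈ts) = ≤-trans (∈⇒occs>0 x∈ts) (m≤n+m (occs x ts) (occ x t))

mutual
  occ>0⇒∈ : ∀ {x} t → 0 < occ x t → x ∈ᵥ t
  occ>0⇒∈ (var y)   p = subst (_∈ᵥ var y) (sym (occ-var>0 p)) here
  occ>0⇒∈ (fn f ts) p = there (occs>0⇒∈ ts p)

  occs>0⇒∈ : ∀ {x} ts → 0 < occs x ts → Any (x ∈ᵥ_) ts
  occs>0⇒∈ {x} (t ∷ ts) p with occ x t in eq
  ... | zero  = there (occs>0⇒∈ ts p)
  ... | suc _ = here (occ>0⇒∈ t (subst (0 <_) (sym eq) z<s))

occ≡0⇒∉ : ∀ {x t} → occ x t ≡ 0 → ¬ x ∈ᵥ t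
occ≡0⇒∉ eq x∈t = <-irrefl (sym eq) (∈⇒occ>0 x∈t)

∉⇒occ≡0 : ∀ {x} t → ¬ x ∈ᵥ t → occ x t ≡ 0
∉⇒occ≡0 t x∉t = n≤0⇒n≡0 (≮⇒≥ (x∉t ∘ occ>0⇒∈ t))

∉⇒occs≡0 : ∀ {x} ts → ¬ Any (x ∈ᵥ_) ts → occs x ts ≡ 0
∉⇒occs≡0 ts x∉ts = ∉⇒occ≡0 (fn 0 ts) λ { (there x∈ts) → x∉ts x∈ts }

single-self : ∀ x t → single x t x ≡ t
single-self x t with x ≡ᵇ x | ≡⇒≡ᵇ x x refl
... | true | _ = refl

single-≢ : ∀ {x z} t → z ≢ x → single x t z ≡ var z
single-≢ {x} {z} t z≢x with z ≡ᵇ x | ≡ᵇ⇒≡ z x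
... | true  | z≡x = ⊥-elim (z≢x (z≡x tt))
... | false | _   = refl

mutual
  occ-sub-single : ∀ {x y} t → y ≢ x → ∀ u →
                   occ y (sub (single x t) u) ≡ occ y u + occ x u * occ y t
  occ-sub-single {x} {y} t y≢x (var z) with z ≟ x
  ... | yes refl rewrite single-self z t | occ-var-≢ y≢x | occ-var-self z = sym (+-identityʳ _)
  ... | no z≢x   rewrite single-≢ t z≢x | occ-var-≢ (z≢x ∘ sym) = sym (+-identityʳ _)
  occ-sub-single t y≢x (fn f us) = occs-subs-single t y≢x us

  occs-subs-single : ∀ {x y} t → y ≢ x → ∀ us →
                     occs y (subs (single x t) us) ≡ occs y us + occs x us * occ y t
  occs-subs-single t y≢x [] = refl
  occs-subs-single {x} {y} t y≢x (u ∷ us)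
    rewrite occ-sub-single t y≢x u | occs-subs-single t y≢x us =
    solve 5 (λ a b c d e → (a :+ b :* e) :+ (c :+ d :* e) := (a :+ c) :+ (b :+ d) :* e) refl
      (occ y u) (occ x u) (occs y us) (occs x us) (occ y t)
    where open +-*-Solver

mutual
  occ-sub-single-self : ∀ {x} t → occ x t ≡ 0 → ∀ u → occ x (sub (single x t) u) ≡ 0
  occ-sub-single-self {x} t x∉t (var z) with z ≟ x
  ... | yes refl rewrite single-self z t = x∉t
  ... | no z≢x   rewrite single-≢ t z≢x = occ-var-≢ (z≢x ∘ sym)
  occ-sub-single-self t x∉t (fn f us) = occs-subs-single-self t x∉t us

  occs-subs-single-self : ∀ {x} t → occ x t ≡ 0 → ∀ us → occs x (subs (single x t) us) ≡ 0
  occs-subs-single-self t x∉t [] = refl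
  occs-subs-single-self t x∉t (u ∷ us)
    rewrite occ-sub-single-self t x∉t u = occs-subs-single-self t x∉t us

mutual
  sub-single-fresh : ∀ {x} t u → occ x u ≡ 0 → sub (single x t) u ≡ u
  sub-single-fresh {x} t (var z) x∉u with z ≟ x
  ... | yes refl = ⊥-elim (1+n≢0 (trans (sym (occ-var-self z)) x∉u))
  ... | no z≢x   = single-≢ t z≢x
  sub-single-fresh t (fn f us) x∉u = cong (fn f) (subs-single-fresh t us x∉u)

  subs-single-fresh : ∀ {x} t us → occs x us ≡ 0 → subs (single x t) us ≡ us
  subs-single-fresh t [] _ = refl
  subs-single-fresh {x} t (u ∷ us) x∉u∷us =
    cong₂ _∷_ (sub-single-fresh t u (m+n≡0⇒m≡0 (occ x u) x∉u∷us))
              (subs-single-fresh t us (m+n≡0⇒n≡0 (occ x u) x∉u∷us))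

mutual
  ∈ᵥ-sub⁺ : ∀ {θ x z} u → z ∈ᵥ u → x ∈ᵥ θ z → x ∈ᵥ sub θ u
  ∈ᵥ-sub⁺ (var z)   here        x∈θz = x∈θz
  ∈ᵥ-sub⁺ (fn f us) (there z∈u) x∈θz = there (∈ᵥ-subs⁺ us z∈u x∈θz)

  ∈ᵥ-subs⁺ : ∀ {θ x z} us → Any (z ∈ᵥ_) us → x ∈ᵥ θ z → Any (x ∈ᵥ_) (subs θ us)
  ∈ᵥ-subs⁺ (u ∷ us) (here z∈u)   x∈θz = here (∈ᵥ-sub⁺ u z∈u x∈θz)
  ∈ᵥ-subs⁺ (u ∷ us) (there z∈us) x∈θz = there (∈ᵥ-subs⁺ us z∈us x∈θz)

mutual
  ∈ᵥ-sub⁻ : ∀ {θ x} u → x ∈ᵥ sub θ u → ∃[ z ] (z ∈ᵥ u × x ∈ᵥ θ z)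
  ∈ᵥ-sub⁻ (var z)   x∈θz = z , here , x∈θz
  ∈ᵥ-sub⁻ (fn f us) (there x∈θus) with ∈ᵥ-subs⁻ us x∈θus
  ... | z , z∈us , x∈θz = z , there z∈us , x∈θz

  ∈ᵥ-subs⁻ : ∀ {θ x} us → Any (x ∈ᵥ_) (subs θ us) → ∃[ z ] (Any (z ∈ᵥ_) us × x ∈ᵥ θ z)
  ∈ᵥ-subs⁻ (u ∷ us) (here x∈θu) with ∈ᵥ-sub⁻ u x∈θu
  ... | z , z∈u , x∈θz = z , here z∈u , x∈θz
  ∈ᵥ-subs⁻ (u ∷ us) (there x∈θus) with ∈ᵥ-subs⁻ us x∈θus
  ... | z , z∈us , x∈θz = z , there z∈us , x∈θz

mutual
  occ-rename : ∀ {ρ} → Injective _≡_ _≡_ ρ → ∀ z u → occ (ρ z) (sub (var ∘ ρ) u) ≡ occ z u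
  occ-rename {ρ} ρ-inj z (var w) with z ≟ w
  ... | yes refl rewrite occ-var-self (ρ z) | occ-var-self z = refl
  ... | no z≢w   rewrite occ-var-≢ z≢w | occ-var-≢ (z≢w ∘ ρ-inj) = refl
  occ-rename ρ-inj z (fn f us) = occs-rename ρ-inj z us

  occs-rename : ∀ {ρ} → Injective _≡_ _≡_ ρ → ∀ z us → occs (ρ z) (subs (var ∘ ρ) us) ≡ occs z us
  occs-rename ρ-inj z []       = refl
  occs-rename ρ-inj z (u ∷ us) = cong₂ _+_ (occ-rename ρ-inj z u) (occs-rename ρ-inj z us)

-- Equation sets

lhs rhs : EqSet → List Term
lhs = map proj₁
rhs = map proj₂

occsˡ occsʳ occsᴱ : ℕ → EqSet → ℕ
occsˡ x E = occs x (lhs E)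
occsʳ x E = occs x (rhs E)
occsᴱ x []            = 0
occsᴱ x ((s , t) ∷ E) = (occ x s + occ x t) + occsᴱ x E

occs-++ : ∀ x ts us → occs x (ts ++ us) ≡ occs x ts + occs x us
occs-++ x []       us = refl
occs-++ x (t ∷ ts) us = trans (cong (occ x t +_) (occs-++ x ts us)) (sym (+-assoc (occ x t) _ _))

occsˡ-++ : ∀ x E F → occsˡ x (E ++ F) ≡ occsˡ x E + occsˡ x F
occsˡ-++ x E F = trans (cong (occs x) (map-++ proj₁ E F)) (occs-++ x (lhs E) (lhs F))

occsʳ-++ : ∀ x E F → occsʳ x (E ++ F) ≡ occsʳ x E + occsʳ x F
occsʳ-++ x E F = trans (cong (occs x) (map-++ proj₂ E F)) (occs-++ x (rhs E) (rhs F))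

occsᴱ-++ : ∀ x E F → occsᴱ x (E ++ F) ≡ occsᴱ x E + occsᴱ x F
occsᴱ-++ x []            F = refl
occsᴱ-++ x ((s , t) ∷ E) F =
  trans (cong (occ x s + occ x t +_) (occsᴱ-++ x E F)) (sym (+-assoc (occ x s + occ x t) _ _))

occsᴱ-zip : ∀ x ss ts → length ss ≡ length ts → occsᴱ x (zip ss ts) ≡ occs x ss + occs x ts
occsᴱ-zip x []       []       _   = refl
occsᴱ-zip x (s ∷ ss) (t ∷ ts) len rewrite occsᴱ-zip x ss ts (suc-injective len) =
  solve 4 (λ a b c d → (a :+ b) :+ (c :+ d) := (a :+ c) :+ (b :+ d)) refl
    (occ x s) (occ x t) (occs x ss) (occs x ts)
  where open +-*-Solver

lhs-zip : ∀ ss ts → length ss ≡ length ts → lhs (zip ss ts) ≡ ss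
lhs-zip []       []       _   = refl
lhs-zip (s ∷ ss) (t ∷ ts) len = cong (s ∷_) (lhs-zip ss ts (suc-injective len))

rhs-zip : ∀ ss ts → length ss ≡ length ts → rhs (zip ss ts) ≡ ts
rhs-zip []       []       _   = refl
rhs-zip (s ∷ ss) (t ∷ ts) len = cong (t ∷_) (rhs-zip ss ts (suc-injective len))

lhs-subE : ∀ θ E → lhs (subE θ E) ≡ subs θ (lhs E)
lhs-subE θ []            = refl
lhs-subE θ ((s , t) ∷ E) = cong (sub θ s ∷_) (lhs-subE θ E)

rhs-subE : ∀ θ E → rhs (subE θ E) ≡ subs θ (rhs E)
rhs-subE θ []            = refl
rhs-subE θ ((s , t) ∷ E) = cong (sub θ t ∷_) (rhs-subE θ E)

occsˡ-subE-single : ∀ {x y} t → y ≢ x → ∀ E →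
                    occsˡ y (subE (single x t) E) ≡ occsˡ y E + occsˡ x E * occ y t
occsˡ-subE-single t y≢x E =
  trans (cong (occs _) (lhs-subE _ E)) (occs-subs-single t y≢x (lhs E))

occsʳ-subE-single : ∀ {x y} t → y ≢ x → ∀ E →
                    occsʳ y (subE (single x t) E) ≡ occsʳ y E + occsʳ x E * occ y t
occsʳ-subE-single t y≢x E =
  trans (cong (occs _) (rhs-subE _ E)) (occs-subs-single t y≢x (rhs E))

occsʳ-subE-single-self : ∀ {x} t → occ x t ≡ 0 → ∀ E → occsʳ x (subE (single x t) E) ≡ 0
occsʳ-subE-single-self t x∉t E =
  trans (cong (occs _) (rhs-subE _ E)) (occs-subs-single-self t x∉t (rhs E))

occsᴱ-subE-single : ∀ {x y} t → y ≢ x → ∀ E →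
                    occsᴱ y (subE (single x t) E) ≡ occsᴱ y E + occsᴱ x E * occ y t
occsᴱ-subE-single t y≢x [] = refl
occsᴱ-subE-single {x} {y} t y≢x ((s , u) ∷ E)
  rewrite occ-sub-single t y≢x s | occ-sub-single t y≢x u | occsᴱ-subE-single t y≢x E =
  solve 7 (λ a b c d e f k → ((a :+ b :* k) :+ (c :+ d :* k)) :+ (e :+ f :* k)
                             := ((a :+ c) :+ e) :+ ((b :+ d) :+ f) :* k) refl
    (occ y s) (occ x s) (occ y u) (occ x u) (occsᴱ y E) (occsᴱ x E) (occ y t)
  where open +-*-Solver

occsᴱ-subE-single-self : ∀ {x} t → occ x t ≡ 0 → ∀ E → occsᴱ x (subE (single x t) E) ≡ 0
occsᴱ-subE-single-self t x∉t [] = refl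
occsᴱ-subE-single-self t x∉t ((s , u) ∷ E)
  rewrite occ-sub-single-self t x∉t s | occ-sub-single-self t x∉t u = occsᴱ-subE-single-self t x∉t E

subE-single-fresh : ∀ {x} t E → occsᴱ x E ≡ 0 → subE (single x t) E ≡ E
subE-single-fresh t [] _ = refl
subE-single-fresh {x} t ((s , u) ∷ E) x∉E =
  cong₂ _∷_ (cong₂ _,_ (sub-single-fresh t s (m+n≡0⇒m≡0 _ x∉s,u))
                       (sub-single-fresh t u (m+n≡0⇒n≡0 (occ x s) x∉s,u)))
            (subE-single-fresh t E (m+n≡0⇒n≡0 (occ x s + occ x u) x∉E))
  where
  x∉s,u : occ x s + occ x u ≡ 0
  x∉s,u = m+n≡0⇒m≡0 _ x∉E

OccursInE⇒occsᴱ>0 : ∀ {x} E → OccursInE x E → 0 < occsᴱ x E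
OccursInE⇒occsᴱ>0 {x} ((s , t) ∷ E) (here (inj₁ x∈s)) =
  ≤-trans (∈⇒occ>0 x∈s) (≤-trans (m≤m+n (occ x s) (occ x t)) (m≤m+n _ (occsᴱ x E)))
OccursInE⇒occsᴱ>0 {x} ((s , t) ∷ E) (here (inj₂ x∈t)) =
  ≤-trans (∈⇒occ>0 x∈t) (≤-trans (m≤n+m (occ x t) (occ x s)) (m≤m+n _ (occsᴱ x E)))
OccursInE⇒occsᴱ>0 {x} ((s , t) ∷ E) (there x∈E) =
  ≤-trans (OccursInE⇒occsᴱ>0 E x∈E) (m≤n+m (occsᴱ x E) (occ x s + occ x t))

occsᴱ>0⇒OccursInE : ∀ {x} E → 0 < occsᴱ x E → OccursInE x E
occsᴱ>0⇒OccursInE {x} ((s , t) ∷ E) p with occ x s in eqs | occ x t in eqt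
... | suc _ | _     = here (inj₁ (occ>0⇒∈ s (subst (0 <_) (sym eqs) z<s)))
... | zero  | suc _ = here (inj₂ (occ>0⇒∈ t (subst (0 <_) (sym eqt) z<s)))
... | zero  | zero  = there (occsᴱ>0⇒OccursInE E p)

occsᴱ-middle : ∀ x E₁ s t E₂ → occsᴱ x (E₁ ++ (s , t) ∷ E₂) ≡ (occ x s + occ x t) + occsᴱ x (E₁ ++ E₂)
occsᴱ-middle x E₁ s t E₂ rewrite occsᴱ-++ x E₁ ((s , t) ∷ E₂) | occsᴱ-++ x E₁ E₂ =
  solve 3 (λ a b c → a :+ (b :+ c) := b :+ (a :+ c)) refl (occsᴱ x E₁) (occ x s + occ x t) (occsᴱ x E₂)
  where open +-*-Solver

occsᴱ-subE-single-unaffected : ∀ {x y} t → y ≢ x → occ y t ≡ 0 → ∀ E →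
                               occsᴱ y (subE (single x t) E) ≡ occsᴱ y E
occsᴱ-subE-single-unaffected {x} {y} t y≢x y∉t E
  rewrite occsᴱ-subE-single t y≢x E | y∉t | *-zeroʳ (occsᴱ x E) = +-identityʳ _

occsˡ-subE-single-unaffected : ∀ {x y} t → y ≢ x → occ y t ≡ 0 → ∀ E →
                               occsˡ y (subE (single x t) E) ≡ occsˡ y E
occsˡ-subE-single-unaffected {x} {y} t y≢x y∉t E
  rewrite occsˡ-subE-single t y≢x E | y∉t | *-zeroʳ (occsˡ x E) = +-identityʳ _

occsʳ-subE-single-unaffected : ∀ {x y} t → y ≢ x → occ y t ≡ 0 → ∀ E →
                               occsʳ y (subE (single x t) E) ≡ occsʳ y E
occsʳ-subE-single-unaffected {x} {y} t y≢x y∉t E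
  rewrite occsʳ-subE-single t y≢x E | y∉t | *-zeroʳ (occsʳ x E) = +-identityʳ _

occsᴱ-sides : ∀ x E → occsᴱ x E ≡ occsˡ x E + occsʳ x E
occsᴱ-sides x [] = refl
occsᴱ-sides x ((s , t) ∷ E) rewrite occsᴱ-sides x E =
  solve 4 (λ a b c d → (a :+ b) :+ (c :+ d) := (a :+ c) :+ (b :+ d)) refl
    (occ x s) (occ x t) (occsˡ x E) (occsʳ x E)
  where open +-*-Solver

∈⇒occ≤occsᴱ : ∀ z {s t} E → (s , t) ∈ E → occ z s ≤ occsᴱ z E
∈⇒occ≤occsᴱ z ((s , t) ∷ E) (here refl) = ≤-trans (m≤m+n (occ z s) (occ z t)) (m≤m+n _ _)
∈⇒occ≤occsᴱ z ((s , t) ∷ E) (there e∈E) = ≤-trans (∈⇒occ≤occsᴱ z E e∈E) (m≤n+m _ _)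

mutual
  size : Term → ℕ
  size (var _)   = 1
  size (fn f ts) = suc (sizes ts)

  sizes : List Term → ℕ
  sizes []       = 0
  sizes (t ∷ ts) = size t + sizes ts

size>0 : ∀ t → 0 < size t
size>0 (var _)  = z<s
size>0 (fn _ _) = z<s

sizes-++ : ∀ ts us → sizes (ts ++ us) ≡ sizes ts + sizes us
sizes-++ []       us = refl
sizes-++ (t ∷ ts) us = trans (cong (size t +_) (sizes-++ ts us)) (sym (+-assoc (size t) _ _))

module _ (ss ts : List Term) (len : length ss ≡ length ts) (W : EqSet) where

  occsˡ-decompose : ∀ {f} S z → occsˡ z (S ++ zip ss ts ++ W) ≡ occsˡ z (S ++ (fn f ss , fn f ts) ∷ W)
  occsˡ-decompose {f} S z rewrite occsˡ-++ z S (zip ss ts ++ W) | occsˡ-++ z S ((fn f ss , fn f ts) ∷ W) =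
    cong (occsˡ z S +_) (trans (occsˡ-++ z (zip ss ts) W)
                               (cong (λ us → occs z us + occsˡ z W) (lhs-zip ss ts len)))

  occsʳ-decompose : ∀ {f} S z → occsʳ z (S ++ zip ss ts ++ W) ≡ occsʳ z (S ++ (fn f ss , fn f ts) ∷ W)
  occsʳ-decompose {f} S z rewrite occsʳ-++ z S (zip ss ts ++ W) | occsʳ-++ z S ((fn f ss , fn f ts) ∷ W) =
    cong (occsʳ z S +_) (trans (occsʳ-++ z (zip ss ts) W)
                               (cong (λ us → occs z us + occsʳ z W) (rhs-zip ss ts len)))

  occsᴱ-decompose : ∀ {f} S z → occsᴱ z (S ++ zip ss ts ++ W) ≡ occsᴱ z (S ++ (fn f ss , fn f ts) ∷ W)
  occsᴱ-decompose {f} S z rewrite occsᴱ-++ z S (zip ss ts ++ W) | occsᴱ-++ z S ((fn f ss , fn f ts) ∷ W)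
                            | occsᴱ-++ z (zip ss ts) W | occsᴱ-zip z ss ts len = refl

  sizesʳ-decompose : sizes (rhs (zip ss ts ++ W)) ≡ sizes ts + sizes (rhs W)
  sizesʳ-decompose rewrite map-++ proj₂ (zip ss ts) W | rhs-zip ss ts len = sizes-++ ts (rhs W)

  sizesˡ-decompose : sizes (lhs (zip ss ts ++ W)) ≡ sizes ss + sizes (lhs W)
  sizesˡ-decompose rewrite map-++ proj₁ (zip ss ts) W | lhs-zip ss ts len = sizes-++ ss (lhs W)

-- Runs of the Martelli–Montanari algorithm

wnsto-◅◅ : ∀ {E F} → Star MMAStep E F → WNSTO F → WNSTO E
wnsto-◅◅ E→F (G , F→G , end) = G , E→F ◅◅ F→G , end

wnsto-clash : ∀ S e W → Clash e → WNSTO (S ++ e ∷ W)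
wnsto-clash S e W clash = _ , ε , inj₁ (Any.++⁺ʳ S (here clash))

wnsto-decompose : ∀ S W f ss g ts →
                  (f ≡ g → length ss ≡ length ts → WNSTO (S ++ zip ss ts ++ W)) →
                  WNSTO (S ++ (fn f ss , fn g ts) ∷ W)
wnsto-decompose S W f ss g ts k with f ≟ g | length ss ≟ length ts
... | no f≢g   | _       = wnsto-clash S _ W (inj₁ f≢g)
... | yes _    | no len≢ = wnsto-clash S _ W (inj₂ len≢)
... | yes refl | yes len = wnsto-◅◅ (act1 S W f ss ts len ◅ ε) (k refl len)

-- Action (5) is only available when x occurs elsewhere; otherwise the substitution is the identity.
eliminate : ∀ S W x t → occ x t ≡ 0 →
            Star MMAStep (S ++ (var x , t) ∷ W)
                         (subE (single x t) S ++ (var x , t) ∷ subE (single x t) W)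
eliminate S W x t x∉t with occsᴱ x (S ++ W) in eq
... | suc _ = act5 S W x t (occ≡0⇒∉ x∉t) (occsᴱ>0⇒OccursInE (S ++ W) (subst (0 <_) (sym eq) z<s)) ◅ ε
... | zero rewrite subE-single-fresh t S (m+n≡0⇒m≡0 _ (trans (sym (occsᴱ-++ x S W)) eq))
                 | subE-single-fresh t W (m+n≡0⇒n≡0 (occsᴱ x S) (trans (sym (occsᴱ-++ x S W)) eq)) = ε

data SolvedIn (E : EqSet) : Equation → Set where
  solved : ∀ {z r} → occsᴱ z E ≡ 1 → SolvedIn E (var z , r)

SolvedIn-cong : ∀ {E F} → (∀ z → occsᴱ z E ≡ occsᴱ z F) → ∀ {e} → SolvedIn E e → SolvedIn F e
SolvedIn-cong E≈F (solved {z} once) = solved (trans (sym (E≈F z)) once)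

terminal : ∀ {E} → All (SolvedIn E) E → Terminal E
terminal all E₁ e E₂ refl with All.++⁻ʳ E₁ all
... | solved {z} {r} once ∷ _ =
  occ≡0⇒∉ (m+n≡0⇒m≡0 (occ z r) rest≡0) ,
  λ z∈E → <-irrefl (sym (m+n≡0⇒n≡0 (occ z r) rest≡0)) (OccursInE⇒occsᴱ>0 (E₁ ++ E₂) z∈E)
  where
  rest≡0 : occ z r + occsᴱ z (E₁ ++ E₂) ≡ 0
  rest≡0 = suc-injective (begin
    suc (occ z r + occsᴱ z (E₁ ++ E₂))
      ≡⟨ cong (λ k → k + occ z r + occsᴱ z (E₁ ++ E₂)) (occ-var-self z) ⟨
    (occ z (var z) + occ z r) + occsᴱ z (E₁ ++ E₂)
      ≡⟨ occsᴱ-middle z E₁ (var z) r E₂ ⟨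
    occsᴱ z (E₁ ++ (var z , r) ∷ E₂)
      ≡⟨ once ⟩
    1 ∎)
    where open ≡-Reasoning

-- Right-linear equation sets

m+n≤1⇒n≡0 : ∀ {m n} → 0 < m → m + n ≤ 1 → n ≡ 0
m+n≤1⇒n≡0 {suc m} _ (s≤s m+n≤0) = n≤0⇒n≡0 (m+n≤o⇒n≤o m m+n≤0)

RightLinear SidesDisjoint : EqSet → Set
RightLinear   W = ∀ y → occsʳ y W ≤ 1
SidesDisjoint W = ∀ y → 0 < occsˡ y W → occsʳ y W ≡ 0

sidesDisjoint⁻ : ∀ {W} → SidesDisjoint W → ∀ y → 0 < occsʳ y W → occsˡ y W ≡ 0
sidesDisjoint⁻ {W} disjoint y p = n≤0⇒n≡0 (≮⇒≥ λ q → <-irrefl (sym (disjoint y q)) p)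

rightLinear-tail : ∀ {e W} → RightLinear (e ∷ W) → RightLinear W
rightLinear-tail {s , t} linear y = m+n≤o⇒n≤o (occ y t) (linear y)

sidesDisjoint-tail : ∀ {e W} → SidesDisjoint (e ∷ W) → SidesDisjoint W
sidesDisjoint-tail {s , t} disjoint y p =
  m+n≡0⇒n≡0 (occ y t) (disjoint y (≤-trans p (m≤n+m _ (occ y s))))

All-subE : ∀ {P Q : Equation → Set} θ S →
           (∀ {s t} → (s , t) ∈ S → P (s , t) → Q (sub θ s , sub θ t)) → All P S → All Q (subE θ S)
All-subE θ []            f []       = []
All-subE θ ((s , t) ∷ S) f (p ∷ ps) = f (here refl) p ∷ All-subE θ S (f ∘ there) ps

solved-outside : ∀ {z r S} F → (var z , r) ∈ S → occsᴱ z (S ++ F) ≡ 1 →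
                 occsᴱ z S ≡ 1 × occsᴱ z F ≡ 0
solved-outside {z} {r} {S} F z∈S once =
  inS , +-cancelˡ-≡ 1 _ _ (trans (cong (_+ occsᴱ z F) (sym inS)) total)
  where
  total : occsᴱ z S + occsᴱ z F ≡ 1
  total = trans (sym (occsᴱ-++ z S F)) once
  inS : occsᴱ z S ≡ 1
  inS = ≤-antisym (≤-trans (m≤m+n _ _) (≤-reflexive total))
                  (subst (_≤ occsᴱ z S) (occ-var-self z) (∈⇒occ≤occsᴱ z S z∈S))

-- The eliminated equation s₀ = t₀ is x = t itself or its orientation t = x.
solved-eliminate : ∀ S W x t s₀ t₀ → occ x t ≡ 0 →
  (∀ z → occ z s₀ + occ z t₀ ≡ occ z (var x) + occ z t) →
  All (SolvedIn (S ++ (s₀ , t₀) ∷ W)) S →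
  All (SolvedIn (subE (single x t) S ++ (var x , t) ∷ subE (single x t) W))
      (subE (single x t) S ++ [ (var x , t) ])
solved-eliminate S W x t s₀ t₀ x∉t same-occs solvedS =
  All.++⁺ (All-subE θ S stays solvedS) (solved new ∷ [])
  where
  θ = single x t
  S₁ = subE θ S
  W₁ = subE θ W
  new : occsᴱ x (S₁ ++ (var x , t) ∷ W₁) ≡ 1
  new rewrite occsᴱ-middle x S₁ (var x) t W₁ | occsᴱ-++ x S₁ W₁ | occ-var-self x | x∉t
            | occsᴱ-subE-single-self t x∉t S | occsᴱ-subE-single-self t x∉t W = refl
  stays : ∀ {s r} → (s , r) ∈ S → SolvedIn (S ++ (s₀ , t₀) ∷ W) (s , r) →
          SolvedIn (S₁ ++ (var x , t) ∷ W₁) (sub θ s , sub θ r)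
  stays z∈S (solved {z} {r} once) =
    subst (λ u → SolvedIn (S₁ ++ (var x , t) ∷ W₁) (u , sub θ r)) (sym (single-≢ t z≢x)) (solved (begin
    occsᴱ z (S₁ ++ (var x , t) ∷ W₁)
      ≡⟨ occsᴱ-middle z S₁ (var x) t W₁ ⟩
    (occ z (var x) + occ z t) + occsᴱ z (S₁ ++ W₁)
      ≡⟨ cong₂ _+_ z∉x,t (occsᴱ-++ z S₁ W₁) ⟩
    occsᴱ z S₁ + occsᴱ z W₁
      ≡⟨ cong₂ _+_ (occsᴱ-subE-single-unaffected t z≢x z∉t S) (occsᴱ-subE-single-unaffected t z≢x z∉t W) ⟩
    occsᴱ z S + occsᴱ z W
      ≡⟨ cong₂ _+_ inS (m+n≡0⇒n≡0 (occ z s₀ + occ z t₀) outside) ⟩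
    1 ∎))
    where
    open ≡-Reasoning
    inS : occsᴱ z S ≡ 1
    inS = proj₁ (solved-outside ((s₀ , t₀) ∷ W) z∈S once)
    outside : (occ z s₀ + occ z t₀) + occsᴱ z W ≡ 0
    outside = proj₂ (solved-outside ((s₀ , t₀) ∷ W) z∈S once)
    z∉x,t : occ z (var x) + occ z t ≡ 0
    z∉x,t = trans (sym (same-occs z)) (m+n≡0⇒m≡0 _ outside)
    z∉t : occ z t ≡ 0
    z∉t = m+n≡0⇒n≡0 (occ z (var x)) z∉x,t
    z≢x : z ≢ x
    z≢x refl = 1+n≢0 (trans (sym (occ-var-self z)) (m+n≡0⇒m≡0 _ z∉x,t))

record LinearSplit (S W : EqSet) : Set where
  field
    solvedPart    : All (SolvedIn (S ++ W)) S
    rightLinear   : RightLinear W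
    sidesDisjoint : SidesDisjoint W

LinearSolvableBelow : ℕ → Set
LinearSolvableBelow n = ∀ S W → sizes (rhs W) < n → LinearSplit S W → WNSTO (S ++ W)

module _ {n} (rec : LinearSolvableBelow n) (S : EqSet) where

  linear-eliminate : ∀ x t W → size t + sizes (rhs W) ≤ n →
                     LinearSplit S ((var x , t) ∷ W) → WNSTO (S ++ (var x , t) ∷ W)
  linear-eliminate x t W size≤n split =
    wnsto-◅◅ (eliminate S W x t x∉t)
      (subst WNSTO (++-assoc S₁ [ (var x , t) ] W₁) (rec (S₁ ++ [ (var x , t) ]) W₁ smaller split₁))
    where
    open LinearSplit split
    S₁ = subE (single x t) S
    W₁ = subE (single x t) W
    x-free : occ x t + occsʳ x W ≡ 0
    x-free = sidesDisjoint x (subst (λ k → 0 < k + occsˡ x W) (sym (occ-var-self x)) z<s)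
    x∉t : occ x t ≡ 0
    x∉t = m+n≡0⇒m≡0 _ x-free
    x∉W : occsʳ x W ≡ 0
    x∉W = m+n≡0⇒n≡0 (occ x t) x-free
    rhs-W₁ : rhs W₁ ≡ rhs W
    rhs-W₁ = trans (rhs-subE _ W) (subs-single-fresh t (rhs W) x∉W)
    smaller : sizes (rhs W₁) < n
    smaller rewrite rhs-W₁ = <-≤-trans (m<n+m _ (size>0 t)) size≤n
    sidesDisjoint₁ : SidesDisjoint W₁
    sidesDisjoint₁ y p with y ≟ x | occ y t in y∈t
    ... | yes refl | _     = trans (cong (occs x) rhs-W₁) x∉W
    ... | no y≢x   | suc _ = trans (cong (occs y) rhs-W₁)
                                   (m+n≤1⇒n≡0 (subst (0 <_) (sym y∈t) z<s) (rightLinear y))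
    ... | no y≢x   | zero  = trans (cong (occs y) rhs-W₁) (m+n≡0⇒n≡0 (occ y t) (sidesDisjoint y
                               (≤-trans (subst (0 <_) (occsˡ-subE-single-unaffected t y≢x y∈t W) p)
                                        (m≤n+m _ (occ y (var x))))))
    split₁ : LinearSplit (S₁ ++ [ (var x , t) ]) W₁
    split₁ = record
      { solvedPart    = subst (λ E → All (SolvedIn E) _) (sym (++-assoc S₁ _ W₁))
                          (solved-eliminate S W x t (var x) t x∉t (λ _ → refl) solvedPart)
      ; rightLinear   = λ y → subst (_≤ 1) (cong (occs y) (sym rhs-W₁))
                                  (rightLinear-tail {var x , t} {W} rightLinear y)
      ; sidesDisjoint = sidesDisjoint₁
      }

  linear-orient : ∀ f ss y W → 1 + sizes (rhs W) ≤ n →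
                  LinearSplit S ((fn f ss , var y) ∷ W) → WNSTO (S ++ (fn f ss , var y) ∷ W)
  linear-orient f ss y W size≤n split =
    wnsto-◅◅ (act4 S W f ss y ◅ eliminate S W y g y∉g)
      (subst WNSTO (trans (++-assoc S₁ _ W) (cong (λ V → S₁ ++ (var y , g) ∷ V) (sym W₁≡W)))
        (rec (S₁ ++ [ (var y , g) ]) W size≤n split₁))
    where
    open LinearSplit split
    g = fn f ss
    S₁ = subE (single y g) S
    y-onceʳ : 0 < occsʳ y ((g , var y) ∷ W)
    y-onceʳ = subst (λ k → 0 < k + occsʳ y W) (sym (occ-var-self y)) z<s
    y∉lhs : occ y g + occsˡ y W ≡ 0
    y∉lhs = sidesDisjoint⁻ {(g , var y) ∷ W} sidesDisjoint y y-onceʳ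
    y∉g : occ y g ≡ 0
    y∉g = m+n≡0⇒m≡0 _ y∉lhs
    W₁≡W : subE (single y g) W ≡ W
    W₁≡W = subE-single-fresh g W (trans (occsᴱ-sides y W)
             (cong₂ _+_ (m+n≡0⇒n≡0 (occ y g) y∉lhs)
                        (m+n≤1⇒n≡0 (subst (0 <_) (sym (occ-var-self y)) z<s) (rightLinear y))))
    split₁ : LinearSplit (S₁ ++ [ (var y , g) ]) W
    split₁ = record
      { solvedPart    = subst (λ V → All (SolvedIn V) (S₁ ++ [ (var y , g) ]))
                          (trans (cong (λ V → S₁ ++ (var y , g) ∷ V) W₁≡W) (sym (++-assoc S₁ _ W)))
                          (solved-eliminate S W y g g (var y) y∉g (λ z → +-comm (occ z g) _) solvedPart)
      ; rightLinear   = rightLinear-tail {g , var y} {W} rightLinear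
      ; sidesDisjoint = sidesDisjoint-tail {g , var y} {W} sidesDisjoint
      }

  linear-decompose : ∀ f ss g ts W → size (fn g ts) + sizes (rhs W) ≤ n →
                     LinearSplit S ((fn f ss , fn g ts) ∷ W) → WNSTO (S ++ (fn f ss , fn g ts) ∷ W)
  linear-decompose f ss g ts W size≤n split = wnsto-decompose S W f ss g ts decomposed
    where
    open LinearSplit split
    decomposed : f ≡ g → length ss ≡ length ts → WNSTO (S ++ zip ss ts ++ W)
    decomposed refl len = rec S (zip ss ts ++ W) smaller (record
      { solvedPart    = All.map (SolvedIn-cong (λ z → sym (occsᴱ-decompose ss ts len W {f} S z))) solvedPart
      ; rightLinear   = λ z → subst (_≤ 1) (sym (occsʳ-decompose ss ts len W {f} [] z)) (rightLinear z)
      ; sidesDisjoint = λ z p → trans (occsʳ-decompose ss ts len W {f} [] z)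
                                  (sidesDisjoint z (subst (0 <_) (occsˡ-decompose ss ts len W {f} [] z) p))
      })
      where
      smaller : sizes (rhs (zip ss ts ++ W)) < n
      smaller = subst (_< n) (sym (sizesʳ-decompose ss ts len W)) size≤n

wnsto-linearSplit : ∀ n → LinearSolvableBelow n
wnsto-linearSplit (suc n) S [] _ split =
  S ++ [] , ε , inj₂ (terminal (All.++⁺ (LinearSplit.solvedPart split) []))
wnsto-linearSplit (suc n) S ((var x , t) ∷ W) (s≤s size≤n) =
  linear-eliminate (wnsto-linearSplit n) S x t W size≤n
wnsto-linearSplit (suc n) S ((fn f ss , var y) ∷ W) (s≤s size≤n) =
  linear-orient (wnsto-linearSplit n) S f ss y W size≤n
wnsto-linearSplit (suc n) S ((fn f ss , fn g ts) ∷ W) (s≤s size≤n) =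
  linear-decompose (wnsto-linearSplit n) S f ss g ts W size≤n

-- Ground left-hand sides

Ground : Term → Set
Ground t = ∀ x → ¬ x ∈ᵥ t

mutual
  ground? : ∀ t → Dec (Ground t)
  ground? (var x)   = no λ g → g x here
  ground? (fn f ts) with grounds? ts
  ... | yes g = yes λ { x (there x∈ts) → g x x∈ts }
  ... | no ¬g = no λ g → ¬g λ x x∈ts → g x (there x∈ts)

  grounds? : ∀ ts → Dec (∀ x → ¬ Any (x ∈ᵥ_) ts)
  grounds? []       = yes λ _ ()
  grounds? (t ∷ ts) with ground? t | grounds? ts
  ... | yes g | yes gs = yes λ { x (here x∈t) → g x x∈t ; x (there x∈ts) → gs x x∈ts }
  ... | no ¬g | _      = no λ gs → ¬g λ x x∈t → gs x (here x∈t)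
  ... | yes _ | no ¬gs = no λ gs → ¬gs λ x x∈ts → gs x (there x∈ts)

GroundedIn : ℕ → EqSet → Set
GroundedIn y W = Any (λ e → Ground (proj₁ e) × y ∈ᵥ proj₂ e) W

ground⇒occ≡0 : ∀ {t} → Ground t → ∀ x → occ x t ≡ 0
ground⇒occ≡0 {t} g x = ∉⇒occ≡0 t (g x)

GroundedIn-zip : ∀ {y} f ss ts → length ss ≡ length ts → Ground (fn f ss) → Any (y ∈ᵥ_) ts →
                 GroundedIn y (zip ss ts)
GroundedIn-zip f (s ∷ ss) (t ∷ ts) _   g (here y∈t)   = here ((λ x x∈s → g x (there (here x∈s))) , y∈t)
GroundedIn-zip f (s ∷ ss) (t ∷ ts) len g (there y∈ts) =
  there (GroundedIn-zip f ss ts (suc-injective len) (λ { x (there x∈ss) → g x (there (there x∈ss)) }) y∈ts)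

GroundedIn-lookup : ∀ {y} ss ts (i : Fin (length ts)) → length ss ≡ length ts →
                    (∀ (j : Fin (length ss)) → toℕ j ≡ toℕ i → Ground (lookup ss j)) →
                    y ∈ᵥ lookup ts i → GroundedIn y (zip ss ts)
GroundedIn-lookup (s ∷ ss) (t ∷ ts) zero    _   ground y∈t = here (ground zero refl , y∈t)
GroundedIn-lookup (s ∷ ss) (t ∷ ts) (suc i) len ground y∈t =
  there (GroundedIn-lookup ss ts i (suc-injective len) (λ j j≡i → ground (suc j) (cong suc j≡i)) y∈t)

GroundedIn-subE : ∀ {y z} g → z ≢ y → ∀ W → GroundedIn z W → GroundedIn z (subE (single y g) W)
GroundedIn-subE g z≢y ((s , t) ∷ W) (here (ground-s , z∈t)) =
  here ( subst Ground (sym (sub-single-fresh g s (ground⇒occ≡0 ground-s _))) ground-s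
       , ∈ᵥ-sub⁺ t z∈t (subst (_ ∈ᵥ_) (sym (single-≢ g z≢y)) here))
GroundedIn-subE g z≢y ((s , t) ∷ W) (there z∈W) = there (GroundedIn-subE g z≢y W z∈W)

module _ (P W : EqSet) {y : ℕ} {g : Term} (g-free : ∀ z → occ z g ≡ 0) where

  occsˡ-bind-ground : ∀ z → z ≢ y →
    occsˡ z (subE (single y g) P ++ (var y , g) ∷ subE (single y g) W) ≡ occsˡ z (P ++ (g , var y) ∷ W)
  occsˡ-bind-ground z z≢y rewrite occsˡ-++ z (subE (single y g) P) ((var y , g) ∷ subE (single y g) W)
    | occsˡ-++ z P ((g , var y) ∷ W) | occ-var-≢ z≢y | g-free z
    | occsˡ-subE-single-unaffected g z≢y (g-free z) P
    | occsˡ-subE-single-unaffected g z≢y (g-free z) W = refl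

  occsʳ-bind-ground : ∀ z → z ≢ y →
    occsʳ z (subE (single y g) P ++ (var y , g) ∷ subE (single y g) W) ≡ occsʳ z (P ++ (g , var y) ∷ W)
  occsʳ-bind-ground z z≢y rewrite occsʳ-++ z (subE (single y g) P) ((var y , g) ∷ subE (single y g) W)
    | occsʳ-++ z P ((g , var y) ∷ W) | occ-var-≢ z≢y | g-free z
    | occsʳ-subE-single-unaffected g z≢y (g-free z) P
    | occsʳ-subE-single-unaffected g z≢y (g-free z) W = refl

  occsʳ-bind-ground-self : occsʳ y (subE (single y g) P ++ (var y , g) ∷ subE (single y g) W) ≡ 0
  occsʳ-bind-ground-self
    rewrite occsʳ-++ y (subE (single y g) P) ((var y , g) ∷ subE (single y g) W) | g-free y
    | occsʳ-subE-single-self g (g-free y) P | occsʳ-subE-single-self g (g-free y) W = refl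

record GroundSplit (P W : EqSet) : Set where
  field
    sidesDisjoint   : SidesDisjoint (P ++ W)
    repeatsGrounded : ∀ y → 2 ≤ occsʳ y (P ++ W) → GroundedIn y W

groundSplit-snoc : ∀ P e W → SidesDisjoint (P ++ e ∷ W) →
                   (∀ y → 2 ≤ occsʳ y (P ++ e ∷ W) → GroundedIn y W) → GroundSplit (P ++ [ e ]) W
groundSplit-snoc P e W disjoint grounded = record
  { sidesDisjoint   = subst SidesDisjoint (sym (++-assoc P [ e ] W)) disjoint
  ; repeatsGrounded = λ y → grounded y ∘ subst (λ E → 2 ≤ occsʳ y E) (++-assoc P [ e ] W)
  }

GroundSolvableBelow : ℕ → Set
GroundSolvableBelow n = ∀ P W → sizes (lhs W) < n → GroundSplit P W → WNSTO (P ++ W)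

-- No equation is left to ground a repeated right-hand variable, so the right-hand sides are linear.
ground-finish : ∀ P → GroundSplit P [] → WNSTO (P ++ [])
ground-finish P split =
  subst WNSTO (sym (++-identityʳ P)) (wnsto-linearSplit _ [] P (n<1+n _) record
    { solvedPart    = []
    ; rightLinear   = λ y → ≮⇒≥ λ repeated →
                        case-empty (repeatsGrounded y
                          (subst (λ E → 2 ≤ occsʳ y E) (sym (++-identityʳ P)) repeated))
    ; sidesDisjoint = subst SidesDisjoint (++-identityʳ P) sidesDisjoint
    })
  where
  open GroundSplit split
  case-empty : ∀ {y} → ¬ GroundedIn y []
  case-empty ()

module _ {n} (rec : GroundSolvableBelow n) (P : EqSet) where

  ground-postpone : ∀ s t W → ¬ Ground s → size s + sizes (lhs W) ≤ n →
                    GroundSplit P ((s , t) ∷ W) → WNSTO (P ++ (s , t) ∷ W)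
  ground-postpone s t W ¬ground size≤n split =
    subst WNSTO (++-assoc P [ (s , t) ] W)
      (rec (P ++ [ (s , t) ]) W (<-≤-trans (m<n+m _ (size>0 s)) size≤n)
        (groundSplit-snoc P (s , t) W sidesDisjoint grounded))
    where
    open GroundSplit split
    grounded : ∀ y → 2 ≤ occsʳ y (P ++ (s , t) ∷ W) → GroundedIn y W
    grounded y repeated with repeatsGrounded y repeated
    ... | here (ground-s , _) = ⊥-elim (¬ground ground-s)
    ... | there y∈W           = y∈W

  ground-bind : ∀ f ss y W → Ground (fn f ss) → size (fn f ss) + sizes (lhs W) ≤ n →
                GroundSplit P ((fn f ss , var y) ∷ W) → WNSTO (P ++ (fn f ss , var y) ∷ W)
  ground-bind f ss y W ground-g size≤n split =
    wnsto-◅◅ (act4 P W f ss y ◅ eliminate P W y g (g-free y))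
      (subst WNSTO (++-assoc P₁ [ (var y , g) ] W₁)
        (rec (P₁ ++ [ (var y , g) ]) W₁ smaller (groundSplit-snoc P₁ (var y , g) W₁ disjoint₁ grounded₁)))
    where
    open GroundSplit split
    g = fn f ss
    P₁ = subE (single y g) P
    W₁ = subE (single y g) W
    g-free : ∀ z → occ z g ≡ 0
    g-free = ground⇒occ≡0 ground-g
    y∈rhs : 0 < occsʳ y (P ++ (g , var y) ∷ W)
    y∈rhs = subst (0 <_) (sym (occsʳ-++ y P _))
              (≤-trans (subst (λ k → 0 < k + occsʳ y W) (sym (occ-var-self y)) z<s) (m≤n+m _ (occsʳ y P)))
    y∉lhsW : occsˡ y W ≡ 0
    y∉lhsW = m+n≡0⇒n≡0 (occ y g) (m+n≡0⇒n≡0 (occsˡ y P)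
               (trans (sym (occsˡ-++ y P _)) (sidesDisjoint⁻ {P ++ (g , var y) ∷ W} sidesDisjoint y y∈rhs)))
    smaller : sizes (lhs W₁) < n
    smaller rewrite lhs-subE (single y g) W | subs-single-fresh g (lhs W) y∉lhsW =
      <-≤-trans (m<n+m _ (size>0 g)) size≤n
    disjoint₁ : SidesDisjoint (P₁ ++ (var y , g) ∷ W₁)
    disjoint₁ z p with z ≟ y
    ... | yes refl = occsʳ-bind-ground-self P W g-free
    ... | no z≢y   = trans (occsʳ-bind-ground P W g-free z z≢y)
                           (sidesDisjoint z (subst (0 <_) (occsˡ-bind-ground P W g-free z z≢y) p))
    grounded₁ : ∀ z → 2 ≤ occsʳ z (P₁ ++ (var y , g) ∷ W₁) → GroundedIn z W₁
    grounded₁ z repeated with z ≟ y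
    ... | yes refl with () ← subst (2 ≤_) (occsʳ-bind-ground-self P W g-free) repeated
    grounded₁ z repeated | no z≢y
      with repeatsGrounded z (subst (2 ≤_) (occsʳ-bind-ground P W g-free z z≢y) repeated)
    ... | here (_ , here) = ⊥-elim (z≢y refl)
    ... | there z∈W       = GroundedIn-subE g z≢y W z∈W

  ground-decompose : ∀ f ss h ts W → Ground (fn f ss) → size (fn f ss) + sizes (lhs W) ≤ n →
                     GroundSplit P ((fn f ss , fn h ts) ∷ W) → WNSTO (P ++ (fn f ss , fn h ts) ∷ W)
  ground-decompose f ss h ts W ground-s size≤n split = wnsto-decompose P W f ss h ts decomposed
    where
    open GroundSplit split
    decomposed : f ≡ h → length ss ≡ length ts → WNSTO (P ++ zip ss ts ++ W)
    decomposed refl len = rec P (zip ss ts ++ W) smaller record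
      { sidesDisjoint   = λ z p → trans (occsʳ-decompose ss ts len W {f} P z)
                                    (sidesDisjoint z (subst (0 <_) (occsˡ-decompose ss ts len W {f} P z) p))
      ; repeatsGrounded = grounded
      }
      where
      smaller : sizes (lhs (zip ss ts ++ W)) < n
      smaller = subst (_< n) (sym (sizesˡ-decompose ss ts len W)) size≤n
      grounded : ∀ y → 2 ≤ occsʳ y (P ++ zip ss ts ++ W) → GroundedIn y (zip ss ts ++ W)
      grounded y repeated
        with repeatsGrounded y (subst (2 ≤_) (occsʳ-decompose ss ts len W {f} P y) repeated)
      ... | here (_ , there y∈ts) = Any.++⁺ˡ (GroundedIn-zip f ss ts len ground-s y∈ts)
      ... | there y∈W             = Any.++⁺ʳ (zip ss ts) y∈W

wnsto-groundSplit : ∀ n → GroundSolvableBelow n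
wnsto-groundSplit (suc n) P [] _ split = ground-finish P split
wnsto-groundSplit (suc n) P ((var x , t) ∷ W) (s≤s size≤n) =
  ground-postpone (wnsto-groundSplit n) P (var x) t W (λ ground → ground x here) size≤n
wnsto-groundSplit (suc n) P ((fn f ss , t) ∷ W) (s≤s size≤n) with ground? (fn f ss) | t
... | no ¬ground | u       = ground-postpone (wnsto-groundSplit n) P (fn f ss) u W ¬ground size≤n
... | yes ground | var y   = ground-bind (wnsto-groundSplit n) P f ss y W ground size≤n
... | yes ground | fn h ts = ground-decompose (wnsto-groundSplit n) P f ss h ts W ground size≤n

wnsto-unify : ∀ p ss ts → length ss ≡ length ts →
              (∀ y → Any (y ∈ᵥ_) ss → ¬ Any (y ∈ᵥ_) ts) →
              (∀ y → 2 ≤ occs y ts → GroundedIn y (zip ss ts)) →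
              WNSTO ((fn p ss , fn p ts) ∷ [])
wnsto-unify p ss ts len disjoint grounded =
  wnsto-decompose [] [] p ss p ts λ _ _ → wnsto-groundSplit _ [] (zip ss ts ++ []) (n<1+n _) record
    { sidesDisjoint   = λ y y∈lhs → trans (occsʳ≡ y)
                          (∉⇒occs≡0 ts (disjoint y (occs>0⇒∈ ss (subst (0 <_) (occsˡ≡ y) y∈lhs))))
    ; repeatsGrounded = λ y repeated → Any.++⁺ˡ (grounded y (subst (2 ≤_) (occsʳ≡ y) repeated))
    }
  where
  occsˡ≡ : ∀ y → occsˡ y (zip ss ts ++ []) ≡ occs y ss
  occsˡ≡ y = trans (occsˡ-decompose ss ts len [] {p} [] y) (+-identityʳ _)
  occsʳ≡ : ∀ y → occsʳ y (zip ss ts ++ []) ≡ occs y ts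
  occsʳ≡ y = trans (occsʳ-decompose ss ts len [] {p} [] y) (+-identityʳ _)

-- Modes

length-subs : ∀ θ ts → length (subs θ ts) ≡ length ts
length-subs θ []       = refl
length-subs θ (t ∷ ts) = cong suc (length-subs θ ts)

lookup-subs⁺ : ∀ θ ts (i : Fin (length ts)) →
               ∃[ j ] (toℕ j ≡ toℕ i × lookup (subs θ ts) j ≡ sub θ (lookup ts i))
lookup-subs⁺ θ (t ∷ ts) zero    = zero , refl , refl
lookup-subs⁺ θ (t ∷ ts) (suc i) with lookup-subs⁺ θ ts i
... | j , j≡i , tⱼ≡ = suc j , cong suc j≡i , tⱼ≡

lookup-subs⁻ : ∀ θ ts (j : Fin (length (subs θ ts))) →
               ∃[ i ] (toℕ i ≡ toℕ j × lookup (subs θ ts) j ≡ sub θ (lookup ts i))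
lookup-subs⁻ θ (t ∷ ts) zero    = zero , refl , refl
lookup-subs⁻ θ (t ∷ ts) (suc j) with lookup-subs⁻ θ ts j
... | i , i≡j , tⱼ≡ = suc i , cong suc i≡j , tⱼ≡

module _ (M : Moding) {m : Mode} {θ : Subst} where

  OccAt-sub⁺ : ∀ A {z x} → OccAt M m A z → x ∈ᵥ θ z → OccAt M m (subA θ A) x
  OccAt-sub⁺ (atom p ts) {z} {x} (i , mode , z∈tᵢ) x∈θz with lookup-subs⁺ θ ts i
  ... | j , j≡i , tⱼ≡ = j , trans (cong₂ (M p) (length-subs θ ts) j≡i) mode
                          , subst (x ∈ᵥ_) (sym tⱼ≡) (∈ᵥ-sub⁺ (lookup ts i) z∈tᵢ x∈θz)

  OccAt-sub⁻ : ∀ A {x} → OccAt M m (subA θ A) x → ∃[ z ] (OccAt M m A z × x ∈ᵥ θ z)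
  OccAt-sub⁻ (atom p ts) {x} (j , mode , x∈tⱼ) with lookup-subs⁻ θ ts j
  ... | i , i≡j , tⱼ≡ with ∈ᵥ-sub⁻ (lookup ts i) (subst (x ∈ᵥ_) tⱼ≡ x∈tⱼ)
  ...   | z , z∈tᵢ , x∈θz = z , (i , trans (cong₂ (M p) (sym (length-subs θ ts)) i≡j) mode , z∈tᵢ) , x∈θz

OutputIn : Moding → Query → Pred ℕ 0ℓ
OutputIn M Q x = Any (λ A → OutPos M A x) Q

-- Inductive form of well-modedness: D holds the variables defined to the left of the query.
WellModedFrom : Moding → Pred ℕ 0ℓ → Query → Set
WellModedFrom M D []      = ⊤
WellModedFrom M D (A ∷ Q) = InPos M A ⊆ D × WellModedFrom M (D ∪ OutPos M A) Q

WellModedClause′ : Moding → Clause → Set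
WellModedClause′ M (H ⇐ B) = OutPos M H ⊆ DefinedIn M H B × WellModedFrom M (InPos M H) B

module _ {M : Moding} where

  ∪-OutputIn-∷ : ∀ {D : Pred ℕ 0ℓ} {A Bs} → D ∪ OutputIn M (A ∷ Bs) ⊆ (D ∪ OutPos M A) ∪ OutputIn M Bs
  ∪-OutputIn-∷ (inj₁ d)         = inj₁ (inj₁ d)
  ∪-OutputIn-∷ (inj₂ (here o))  = inj₁ (inj₂ o)
  ∪-OutputIn-∷ (inj₂ (there o)) = inj₂ o

  WellModedFrom-mono : ∀ {D D′} → D ⊆ D′ → ∀ Q → WellModedFrom M D Q → WellModedFrom M D′ Q
  WellModedFrom-mono D⊆D′ []      _            = tt
  WellModedFrom-mono D⊆D′ (A ∷ Q) (ins , rest) =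
    D⊆D′ ∘ ins , WellModedFrom-mono (map₁ D⊆D′) Q rest

  WellModedFrom-++ : ∀ {D} B Q → WellModedFrom M D B → WellModedFrom M (D ∪ OutputIn M B) Q →
                     WellModedFrom M D (B ++ Q)
  WellModedFrom-++ []      Q _            wm-Q = WellModedFrom-mono (fromInj₁ λ ()) Q wm-Q
  WellModedFrom-++ {D} (A ∷ B) Q (ins , wm-B) wm-Q =
    ins , WellModedFrom-++ B Q wm-B (WellModedFrom-mono (∪-OutputIn-∷ {D}) Q wm-Q)

  WellModedFrom-take : ∀ {D} B → (∀ (j : Fin (length B)) x → InPos M (lookup B j) x →
                         (D ∪ OutputIn M (take (toℕ j) B)) x) → WellModedFrom M D B
  WellModedFrom-take []      _  = tt
  WellModedFrom-take {D} (A ∷ B) wm =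
    (λ {x} in-A → fromInj₁ (λ ()) (wm zero x in-A)) ,
    WellModedFrom-take B (λ j x in-Bⱼ → ∪-OutputIn-∷ {D} (wm (suc j) x in-Bⱼ))

  wellModedClause′ : ∀ C → WellModedClause M C → WellModedClause′ M C
  wellModedClause′ (H ⇐ B) (outs , ins) = outs _ , WellModedFrom-take B ins

  wellModedQuery′ : ∀ Q → WellModedQuery M Q → WellModedFrom M ∅ Q
  wellModedQuery′ Q (_ , ins) = WellModedFrom-mono no-positions Q (WellModedFrom-take Q ins)
    where
    no-positions : InPos M (atom 0 []) ⊆ ∅
    no-positions (() , _)

subQ-++ : ∀ θ B Q → subQ θ (B ++ Q) ≡ subQ θ B ++ subQ θ Q
subQ-++ θ []      Q = refl
subQ-++ θ (A ∷ B) Q = cong (subA θ A ∷_) (subQ-++ θ B Q)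

Any-subQ⁺ : ∀ {P R : Atom → Set} θ Q → (∀ {A} → P A → R (subA θ A)) → Any P Q → Any R (subQ θ Q)
Any-subQ⁺ θ (A ∷ Q) f (here p)  = here (f p)
Any-subQ⁺ θ (A ∷ Q) f (there p) = there (Any-subQ⁺ θ Q f p)

All-subQ⁺ : ∀ {P R : Atom → Set} θ Q → (∀ {A} → P A → R (subA θ A)) → All P Q → All R (subQ θ Q)
All-subQ⁺ θ []      f []       = []
All-subQ⁺ θ (A ∷ Q) f (p ∷ ps) = f p ∷ All-subQ⁺ θ Q f ps

module _ {M : Moding} (θ : Subst) where

  DefinedIn-sub : ∀ H B {z x} → DefinedIn M H B z → x ∈ᵥ θ z → DefinedIn M (subA θ H) (subQ θ B) x
  DefinedIn-sub H B (inj₁ in-H)  x∈θz = inj₁ (OccAt-sub⁺ M H in-H x∈θz)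
  DefinedIn-sub H B (inj₂ out-B) x∈θz = inj₂ (Any-subQ⁺ θ B (λ {A} o → OccAt-sub⁺ M A o x∈θz) out-B)

  WellModedFrom-sub : ∀ {D D′ : Pred ℕ 0ℓ} → (∀ {z x} → D z → x ∈ᵥ θ z → D′ x) →
                      ∀ Q → WellModedFrom M D Q → WellModedFrom M D′ (subQ θ Q)
  WellModedFrom-sub D→D′ []      _            = tt
  WellModedFrom-sub {D} {D′} D→D′ (A ∷ Q) (ins , rest) =
    (λ in-Aθ → let z , in-A , x∈θz = OccAt-sub⁻ M A in-Aθ in D→D′ (ins in-A) x∈θz) ,
    WellModedFrom-sub extend Q rest
    where
    extend : ∀ {z x} → (D ∪ OutPos M A) z → x ∈ᵥ θ z → (D′ ∪ OutPos M (subA θ A)) x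
    extend (inj₁ d) x∈θz = inj₁ (D→D′ d x∈θz)
    extend (inj₂ o) x∈θz = inj₂ (OccAt-sub⁺ M A o x∈θz)

  WellModedClause′-sub : ∀ H B → WellModedClause′ M (H ⇐ B) → WellModedClause′ M (subA θ H ⇐ subQ θ B)
  WellModedClause′-sub H B (outs , wm-B) =
    (λ out-Hθ → let z , out-H , x∈θz = OccAt-sub⁻ M H out-Hθ in DefinedIn-sub H B (outs out-H) x∈θz) ,
    WellModedFrom-sub (OccAt-sub⁺ M H) B wm-B

WellModedFrom-resolvent : ∀ {M} a q B → WellModedFrom M ∅ (a ∷ q) → WellModedClause′ M (a ⇐ B) →
                          WellModedFrom M ∅ (B ++ q)
WellModedFrom-resolvent {M} a q B (ground-a , wm-q) (outs-a , wm-B) =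
  WellModedFrom-++ B q (WellModedFrom-mono ground-a B wm-B) (WellModedFrom-mono outputs-of-a q wm-q)
  where
  outputs-of-a : ∅ ∪ OutPos M a ⊆ ∅ ∪ OutputIn M B
  outputs-of-a (inj₂ out-a) with outs-a out-a
  ... | inj₁ in-a  = ⊥-elim (ground-a in-a)
  ... | inj₂ out-B = inj₂ out-B

GroundInputs : Moding → Atom → Set
GroundInputs M A = InPos M A ⊆ ∅

module _ {M : Moding} (noOutput : NoOutput M) where

  inputs-defined : ∀ {D} Q → WellModedFrom M D Q → All (λ A → InPos M A ⊆ D) Q
  inputs-defined []      _            = []
  inputs-defined (A ∷ Q) (ins , rest) =
    ins ∷ All.map (λ ⊆D∪out {_} in-A′ → fromInj₁ (⊥-elim ∘ no-outputs) (⊆D∪out in-A′))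
                  (inputs-defined Q rest)
    where
    no-outputs : ∀ {x} → ¬ OutPos M A x
    no-outputs (_ , mode , _) = noOutput _ _ _ mode

GroundInputs-sub : ∀ {M} θ A → GroundInputs M A → GroundInputs M (subA θ A)
GroundInputs-sub {M} θ A ground-A in-Aθ = let _ , in-A , _ = OccAt-sub⁻ M A in-Aθ in ground-A in-A

module _ {M : Moding} (noOutput : NoOutput M) (θ : Subst) where

  -- Without outputs every input of the body comes from an input of the head, which θ grounds.
  GroundInputs-body : ∀ A H B → GroundInputs M A → subA θ H ≡ subA θ A → WellModedClause′ M (H ⇐ B) →
                      All (GroundInputs M) (subQ θ B)
  GroundInputs-body A H B ground-A unifies (_ , wm-B) =
    All-subQ⁺ θ B (λ {A′} → grounded {A′}) (inputs-defined noOutput B wm-B)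
    where
    grounded : ∀ {A′} → InPos M A′ ⊆ InPos M H → GroundInputs M (subA θ A′)
    grounded {A′} inputs-from-H in-A′θ =
      let z , in-A′ , x∈θz = OccAt-sub⁻ M A′ in-A′θ
          in-Aθ = subst (λ B → InPos M B _) unifies (OccAt-sub⁺ M H (inputs-from-H in-A′) x∈θz)
          _ , in-A , _ = OccAt-sub⁻ M A in-Aθ
      in ground-A in-A

-- Selected atoms in SLD-trees

-- A repeated variable of the head sits in an input position, opposite a ground argument of A.
wnsto-atoms : ∀ M A H → GroundInputs M A → WeaklyLinear M H → (∀ x → x ∈ᵥA H → ¬ x ∈ᵥA A) →
              SamePred A H → WNSTO ((atomTerm A , atomTerm H) ∷ [])
wnsto-atoms M (atom p ss) (atom .p ts) ground-A linear-H apart (refl , len) =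
  wnsto-unify p ss ts len (λ y y∈ss y∈ts → apart y y∈ts y∈ss) grounded
  where
  grounded : ∀ y → 2 ≤ occs y ts → GroundedIn y (zip ss ts)
  grounded y repeated with linear-H y repeated
  ... | i , mode , y∈tᵢ =
    GroundedIn-lookup ss ts i len
      (λ j j≡i x x∈sⱼ → ground-A (j , trans (cong₂ (M p) len j≡i) mode , x∈sⱼ)) y∈tᵢ

WeaklyLinear-rename : ∀ {M ρ} → Injective _≡_ _≡_ ρ → ∀ H → WeaklyLinear M H →
                      WeaklyLinear M (subA (var ∘ ρ) H)
WeaklyLinear-rename {M} {ρ} ρ-inj H linear y repeated
  with ∈ᵥ-subs⁻ (args H) (occs>0⇒∈ (subs (var ∘ ρ) (args H)) (≤-trans (s≤s z≤n) repeated))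
... | z , _ , here = OccAt-sub⁺ M H (linear z (subst (2 ≤_) (occs-rename ρ-inj z (args H)) repeated)) here

wellModedClause′-rename : ∀ {M} ρ C → WellModedClause M C → WellModedClause′ M (rename ρ C)
wellModedClause′-rename ρ (H ⇐ B) wm = WellModedClause′-sub (var ∘ ρ) H B (wellModedClause′ (H ⇐ B) wm)

variant-wellModed : ∀ {M P C Q C′} → WellModedProgram M P → C ∈ P → Variant C Q C′ → WellModedClause′ M C′
variant-wellModed {C = C} wm-P C∈P (ρ , _ , refl , _) = wellModedClause′-rename ρ C (All.lookup wm-P C∈P)

variant-weaklyLinear : ∀ {M P C Q C′} → All (WeaklyLinear M ∘ head) P → C ∈ P → Variant C Q C′ →
                       WeaklyLinear M (head C′)
variant-weaklyLinear {M} {C = H ⇐ B} linear-P C∈P (ρ , ρ-inj , refl , _) =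
  WeaklyLinear-rename {M} ρ-inj H (All.lookup linear-P C∈P)

variant-apart : ∀ {C Q C′ A} → Variant C Q C′ → A ∈ Q → ∀ x → x ∈ᵥA head C′ → ¬ x ∈ᵥA A
variant-apart (_ , _ , _ , fresh) A∈Q x x∈H x∈A = fresh x (inj₁ x∈H) (lose A∈Q x∈A)

prolog-wellModed : ∀ {M P Q₀ Q h} → WellModedProgram M P → WellModedQuery M Q₀ →
                   SLDNode P prologRule Q₀ (Q ∷ h) → WellModedFrom M ∅ Q
prolog-wellModed wm-P wm-Q₀ root = wellModedQuery′ _ wm-Q₀
prolog-wellModed {M} wm-P wm-Q₀ (step {a} {q} node C C∈P C′ variant θ (unifies , _)) =
  subst (WellModedFrom M ∅) (sym (subQ-++ θ (body C′) q))
    (WellModedFrom-resolvent (subA θ a) (subQ θ q) (subQ θ (body C′))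
      (WellModedFrom-sub θ (λ ()) (a ∷ q) (prolog-wellModed wm-P wm-Q₀ node))
      (subst (λ H → WellModedClause′ M (H ⇐ subQ θ (body C′))) (sym unifies)
        (WellModedClause′-sub θ (head C′) (body C′) (variant-wellModed {M} wm-P C∈P variant))))

All-resolvent : ∀ {P : Atom → Set} θ Q i B → (∀ {A} → P A → P (subA θ A)) →
                All P Q → All P (subQ θ B) → All P (subQ θ (replaceAt Q i B))
All-resolvent θ Q i B P-sub P-Q P-B
  rewrite subQ-++ θ (take (toℕ i) Q) (B ++ drop (suc (toℕ i)) Q) | subQ-++ θ B (drop (suc (toℕ i)) Q) =
  All.++⁺ (All-subQ⁺ θ _ P-sub (All.take⁺ (toℕ i) P-Q))
          (All.++⁺ P-B (All-subQ⁺ θ _ P-sub (All.drop⁺ (suc (toℕ i)) P-Q)))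

noOutput-groundInputs : ∀ {M P Q₀ R Q h} → NoOutput M → WellModedProgram M P → WellModedQuery M Q₀ →
                        SLDNode P R Q₀ (Q ∷ h) → All (GroundInputs M) Q
noOutput-groundInputs noOutput wm-P wm-Q₀ root = inputs-defined noOutput _ (wellModedQuery′ _ wm-Q₀)
noOutput-groundInputs {M} {R = R} noOutput wm-P wm-Q₀
                      (step {a} {q} {h} node C C∈P C′ variant θ (unifies , _)) =
  All-resolvent θ (a ∷ q) i (body C′) (λ {A} → GroundInputs-sub {M} θ A) ground-Q
    (GroundInputs-body noOutput θ (lookup (a ∷ q) i) (head C′) (body C′)
      (All.lookup ground-Q (∈-lookup i)) (sym unifies) (variant-wellModed {M} wm-P C∈P variant))
  where
  i = R h a q
  ground-Q = noOutput-groundInputs noOutput wm-P wm-Q₀ node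

wnsto-available : ∀ {M P Q A C C′} → All (WeaklyLinear M ∘ head) P → C ∈ P → Variant C Q C′ →
                  A ∈ Q → GroundInputs M A → SamePred A (head C′) →
                  WNSTO ((atomTerm A , atomTerm (head C′)) ∷ [])
wnsto-available {M} {A = A} {C′ = C′} linear-P C∈P variant A∈Q ground-A =
  wnsto-atoms M A (head C′) (λ {x} → ground-A {x})
    (variant-weaklyLinear {M} linear-P C∈P variant) (variant-apart variant A∈Q)

corollary20 : (M : Moding) (P : Program) (Q : Query) →
    WellModedProgram M P →
    All (λ C → WeaklyLinear M (head C)) P →
    WellModedQuery M Q →
    WeaklyOCFree P prologRule Q ×
    (NoOutput M → (R : SelectionRule) → WeaklyOCFree P R Q)
corollary20 M P Q wm-P linear-P wm-Q = prolog , anyRule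
  where
  prolog : WeaklyOCFree P prologRule Q
  prolog node C C∈P C′ variant =
    wnsto-available {M} linear-P C∈P variant (here refl) (proj₁ (prolog-wellModed {M} wm-P wm-Q node))
  anyRule : NoOutput M → (R : SelectionRule) → WeaklyOCFree P R Q
  anyRule noOutput R {a} {q} {h} node C C∈P C′ variant =
    wnsto-available {M} linear-P C∈P variant (∈-lookup (R h a q))
      (All.lookup (noOutput-groundInputs {M} noOutput wm-P wm-Q node) (∈-lookup (R h a q)))
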